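{- Let $b\geq 1$ be odd, let $1\leq k\leq n-2$, and let $\mathbf{s}=s_1\ldots s_k$ be such that the set $\mathbf{s}\,|\,R_n(b)$ is nonempty. Let $\mathbf{t}$ be the $\prec$-first sequence in $\mathbf{s}\,|\,R_n(b)$, and let $M=\min\{b,\max\{s_i\}_{i=1}^k+1\}$. Then: (1) if $\sum_{i=1}^k s_i$ is odd and $M$ is odd, then $\mathbf{t}=\mathbf{s}M0\ldots0$; (2) if $\sum_{i=1}^k s_i$ is odd and $M$ is even, then $\mathbf{t}=\mathbf{s}M(M+1)0\ldots0$; (3) if $\sum_{i=1}^k s_i$ is even, then $\mathbf{t}=\mathbf{s}0\ldots0$. (In each case the sequence is completed with zeros up to length $n$.)
   Context: A restricted growth function of length $n$ is an integer sequence $s_1\ldots s_n$ with $s_1=0$ and $0\leq s_{i+1}\leq \max\{s_j\}_{j=1}^{i}+1$ for $1\leq i\leq n-1$; $R_n$ is the set of these, and $R_n(b)=\{s\in R_n:\max_i s_i\leq b\}$. For a sequence $\mathbf{u}$ and a set $S$ of sequences, $\mathbf{u}\,|\,S$ denotes the subset of $S$ of sequences having prefix $\mathbf{u}$. The Reflected Gray Code Order $\prec$ on integer sequences of length $n$ with entries in $\{0,\ldots,m-1\}$: $s_1\ldots s_n\prec t_1\ldots t_n$ if for some $k$ with $s_i=t_i$ ($i<k$) and $s_k\neq t_k$, either $\sum_{i=1}^{k-1}s_i$ is even and $s_k<t_k$, or it is odd and $s_k>t_k$. The $\prec$-first sequence of a set is its first element when listed in increasing $\prec$ order. -}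

module Defs where

open import Data.Nat using (ℕ; zero; suc; _+_; _∸_; _≤_; _<_; _>_; _⊔_; _⊓_; _%_)
open import Data.List using (List; []; _∷_; _++_; length; foldr; replicate)
open import Data.Nat.ListAction using (sum)
open import Data.List.Relation.Unary.All using (All)
open import Data.Product using (_×_; ∃; ∃-syntax)
open import Data.Sum using (_⊎_)
open import Data.Unit using (⊤)
open import Relation.Binary.PropositionalEquality using (_≡_; _≢_)

RGTail : ℕ → List ℕ → Set
RGTail m []       = ⊤
RGTail m (x ∷ xs) = (x ≤ suc m) × RGTail (m ⊔ x) xs

IsRGF : List ℕ → Set
IsRGF []       = ⊤
IsRGF (x ∷ xs) = (x ≡ 0) × RGTail x xs

InR : ℕ → ℕ → List ℕ → Set
InR n b s = (length s ≡ n) × IsRGF s × All (_≤ b) s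

InPrefixR : List ℕ → ℕ → ℕ → List ℕ → Set
InPrefixR u n b s = InR n b s × ∃[ r ] (s ≡ u ++ r)

Even Odd : ℕ → Set
Even x = x % 2 ≡ 0
Odd  x = x % 2 ≡ 1

_≺_ : List ℕ → List ℕ → Set
s ≺ t = ∃[ u ] ∃[ a ] ∃[ c ] ∃[ r₁ ] ∃[ r₂ ]
          (s ≡ u ++ (a ∷ r₁)) × (t ≡ u ++ (c ∷ r₂)) × (a ≢ c) ×
          ((Even (sum u) × a < c) ⊎ (Odd (sum u) × a > c))

IsFirst : (List ℕ → Set) → List ℕ → Set
IsFirst S t = S t × (∀ u → S u → u ≢ t → t ≺ u)

maxL : List ℕ → ℕ
maxL = foldr _⊔_ 0

module Submission where

-- Every member of  s | R_n(b)  has the form  s ++ x,  where the tail x is a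
-- valid continuation: restricted growth relative to the running maximum
-- m = max s, and entries bounded by b.  Comparing  s ++ x  with  s ++ y  in
-- Gray code order is comparing the tails x and y in the Gray code order
-- "shifted" by the digit sum σ = sum s (the parity of the prefix sum before a
-- position decides the direction).  So it suffices to exhibit, for each
-- case, a valid candidate tail y that no valid tail precedes in the σ-shifted
-- order; uniqueness of the ≺-first element then identifies t with s ++ y.
--
-- The minimality arguments all rest on one decomposition: a comparison of
-- a ∷ x with c ∷ y is either decided at the head, or a ≡ c and the
-- comparison continues on x, y with offset σ + c.  With an even offset the
-- all-zero tail is minimal (nothing is below 0); with an odd offset a head
-- carrying the largest admissible value cannot be beaten, and the offset
-- after it changes parity as the parity of that value dictates.

open import Defs
open import Data.Nat using (ℕ; zero; suc; _+_; _∸_; _≤_; _<_; _>_; _%_; z≤n; _⊓_; _⊔_; s≤s; _≟_)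
open import Data.Nat.Properties
  using ( +-assoc; +-identityʳ; ∸-+-assoc; m+[n∸m]≡n; n≮0; ≤⇒≯; ≤-trans; ≤∧≢⇒<; <-irrefl
        ; n≤1+n; ≤-refl; +-monoʳ-≤; ⊓-sel; ⊓-glb; m⊓n≤m; m⊓n≤n; ⊔-lub; m≤n⊔m; ⊔-assoc; ⊔-identityʳ)
open import Data.Nat.DivMod using (%-distribˡ-+)
open import Data.List using (List; []; _∷_; _++_; length; replicate)
open import Data.List.Properties using (≡-dec; length-++; length-replicate)
open import Data.Nat.ListAction using (sum)
open import Data.List.Relation.Unary.All using (All; []; _∷_)
open import Data.List.Relation.Unary.All.Properties using (++⁺; ++⁻ˡ; ++⁻ʳ)
open import Data.Product using (_×_; ∃-syntax; _,_; proj₁; proj₂)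
open import Data.Sum using (_⊎_; inj₁; inj₂)
open import Data.Empty using (⊥; ⊥-elim)
open import Data.Unit using (tt)
open import Relation.Nullary using (¬_; yes; no)
open import Relation.Binary.PropositionalEquality
  using (_≡_; _≢_; refl; sym; trans; cong; subst; module ≡-Reasoning)

even≢odd : ∀ x → Even x → Odd x → ⊥
even≢odd _ e o with trans (sym e) o
... | ()

parity-+ : ∀ x y → (x + y) % 2 ≡ (x % 2 + y % 2) % 2
parity-+ x y = %-distribˡ-+ x y 2

odd+odd : ∀ x y → Odd x → Odd y → Even (x + y)
odd+odd x y ox oy rewrite parity-+ x y | ox | oy = refl

odd+even : ∀ x y → Odd x → Even y → Odd (x + y)
odd+even x y ox ey rewrite parity-+ x y | ox | ey = refl

even⇒odd-suc : ∀ x → Even x → Odd (suc x)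
even⇒odd-suc x = odd+even 1 x refl

odd-⊓-even : ∀ b n → Odd b → Even (b ⊓ n) → b ⊓ n ≡ n
odd-⊓-even b n ob e with ⊓-sel b n
... | inj₁ ⊓≡b = ⊥-elim (even≢odd b (subst Even ⊓≡b e) ob)
... | inj₂ ⊓≡n = ⊓≡n

IsRGF≤ : ℕ → List ℕ → Set
IsRGF≤ b s = IsRGF s × All (_≤ b) s

ValidTail : ℕ → ℕ → List ℕ → Set
ValidTail m b x = RGTail m x × All (_≤ b) x

rg-split : ∀ m s y → RGTail m (s ++ y) → RGTail m s × RGTail (m ⊔ maxL s) y
rg-split m []      y r = tt , subst (λ k → RGTail k y) (sym (⊔-identityʳ m)) r
rg-split m (a ∷ s) y (a≤ , r) with rg-split (m ⊔ a) s y r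
... | rs , ry = (a≤ , rs) , subst (λ k → RGTail k y) (⊔-assoc m a (maxL s)) ry

rg-join : ∀ m s y → RGTail m s → RGTail (m ⊔ maxL s) y → RGTail m (s ++ y)
rg-join m []      y _        ry = subst (λ k → RGTail k y) (⊔-identityʳ m) ry
rg-join m (a ∷ s) y (a≤ , rs) ry =
  a≤ , rg-join (m ⊔ a) s y rs (subst (λ k → RGTail k y) (sym (⊔-assoc m a (maxL s))) ry)

prefix-split : ∀ {b} h s x → IsRGF≤ b ((h ∷ s) ++ x) →
  IsRGF≤ b (h ∷ s) × ValidTail (maxL (h ∷ s)) b x
prefix-split h s x ((h≡0 , rg) , bounded) with rg-split h s x rg
... | rs , rx = ((h≡0 , rs) , ++⁻ˡ (h ∷ s) bounded) , rx , ++⁻ʳ (h ∷ s) bounded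

prefix-join : ∀ {b} h s x → IsRGF≤ b (h ∷ s) → ValidTail (maxL (h ∷ s)) b x →
  IsRGF≤ b ((h ∷ s) ++ x)
prefix-join h s x ((h≡0 , rs) , bs) (rx , bx) = (h≡0 , rg-join h s x rs rx) , ++⁺ bs bx

∷-valid : ∀ {m b a x} → a ≤ suc m → a ≤ b → ValidTail (m ⊔ a) b x → ValidTail m b (a ∷ x)
∷-valid a≤sm a≤b (rx , bx) = (a≤sm , rx) , (a≤b ∷ bx)

zeros-valid : ∀ m b j → ValidTail m b (replicate j 0)
zeros-valid m b zero    = tt , []
zeros-valid m b (suc j) = ∷-valid z≤n z≤n (zeros-valid (m ⊔ 0) b j)

head-bound : ∀ {m b a x} → ValidTail m b (a ∷ x) → a ≤ b ⊓ suc m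
head-bound ((a≤sm , _) , (a≤b ∷ _)) = ⊓-glb a≤b a≤sm

data GrayStep (σ a c : ℕ) : Set where
  ascending  : Even σ → a < c → GrayStep σ a c
  descending : Odd σ → a > c → GrayStep σ a c

gray-step-≢ : ∀ {σ a c} → GrayStep σ a c → a ≢ c
gray-step-≢ (ascending  _ a<c) refl = <-irrefl refl a<c
gray-step-≢ (descending _ a>c) refl = <-irrefl refl a>c

record TailBefore (σ : ℕ) (x y : List ℕ) : Set where
  constructor tail-before
  field
    common   : List ℕ
    {a c}    : ℕ
    {r₁ r₂}  : List ℕ
    x-split  : x ≡ common ++ (a ∷ r₁)
    y-split  : y ≡ common ++ (c ∷ r₂)
    step     : GrayStep (σ + sum common) a c

≺⇒before : ∀ {u v} → u ≺ v → TailBefore 0 u v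
≺⇒before (q , _ , _ , _ , _ , eu , ev , _ , inj₁ (e , a<c)) = tail-before q eu ev (ascending e a<c)
≺⇒before (q , _ , _ , _ , _ , eu , ev , _ , inj₂ (o , a>c)) = tail-before q eu ev (descending o a>c)

before-nilˡ : ∀ {σ y} → ¬ TailBefore σ [] y
before-nilˡ (tail-before []      () _ _)
before-nilˡ (tail-before (_ ∷ _) () _ _)

before-nilʳ : ∀ {σ x} → ¬ TailBefore σ x []
before-nilʳ (tail-before []      _ () _)
before-nilʳ (tail-before (_ ∷ _) _ () _)

before-∷ : ∀ {σ a c x y} → TailBefore σ (a ∷ x) (c ∷ y) →
  GrayStep σ a c ⊎ (a ≡ c × TailBefore (σ + c) x y)
before-∷ {σ} {a} {c} (tail-before [] refl refl step) =
  inj₁ (subst (λ τ → GrayStep τ a c) (+-identityʳ σ) step)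
before-∷ {σ} (tail-before (q₀ ∷ q) {a′} {c′} refl refl step) =
  inj₂ (refl , tail-before q refl refl (subst (λ τ → GrayStep τ a′ c′) (sym (+-assoc σ q₀ (sum q))) step))

before-++ : ∀ {x y} σ s → TailBefore σ (s ++ x) (s ++ y) → TailBefore (σ + sum s) x y
before-++ {x} {y} σ [] p = subst (λ τ → TailBefore τ x y) (sym (+-identityʳ σ)) p
before-++ {x} {y} σ (h ∷ s) p with before-∷ p
... | inj₁ step     = ⊥-elim (gray-step-≢ step refl)
... | inj₂ (_ , p′) = subst (λ τ → TailBefore τ x y) (+-assoc σ h (sum s)) (before-++ (σ + h) s p′)

descend : ∀ σ {a c x y} → Odd σ → a ≤ c → TailBefore σ (a ∷ x) (c ∷ y) → TailBefore (σ + c) x y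
descend σ oσ a≤c p with before-∷ p
... | inj₁ (ascending eσ _)   = ⊥-elim (even≢odd σ eσ oσ)
... | inj₁ (descending _ a>c) = ⊥-elim (≤⇒≯ a≤c a>c)
... | inj₂ (_ , p′)           = p′

zeros-minimal : ∀ σ j x → Even σ → ¬ TailBefore σ x (replicate j 0)
zeros-minimal _ zero    x       _  p = before-nilʳ p
zeros-minimal _ (suc j) []      _  p = before-nilˡ p
zeros-minimal σ (suc j) (a ∷ x) eσ p with before-∷ p
... | inj₁ (ascending _ a<0)  = n≮0 a<0
... | inj₁ (descending oσ _) = even≢odd σ eσ oσ
... | inj₂ (_ , p′)        = zeros-minimal (σ + 0) j x (subst Even (sym (+-identityʳ σ)) eσ) p′

-- Odd offset, odd largest admissible head M = min(b, m + 1): the tail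
-- M 0 … 0 is minimal, the offset becoming even after M.
single-minimal : ∀ σ {m b} j x → Odd σ → Odd (b ⊓ suc m) → ValidTail m b x →
  ¬ TailBefore σ x (b ⊓ suc m ∷ replicate j 0)
single-minimal _ j []      _  _  _ p = before-nilˡ p
single-minimal σ {m} {b} j (a ∷ x) oσ oM v p =
  zeros-minimal (σ + b ⊓ suc m) j x (odd+odd σ (b ⊓ suc m) oσ oM) (descend σ oσ (head-bound v) p)

-- Odd offset, even largest admissible head m + 1: the tail
-- (m+1) (m+2) 0 … 0 is minimal; after m + 1 the offset stays odd, the
-- next entry is at most m + 2, and after it the offset is even.
double-minimal : ∀ σ m j x → Odd σ → Even (suc m) → RGTail m x →
  ¬ TailBefore σ x (suc m ∷ suc (suc m) ∷ replicate j 0)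
double-minimal _ _ j [] _ _ _ p = before-nilˡ p
double-minimal σ m j (a ∷ x) oσ em (a≤sm , rx) p = on-rest x rx (descend σ oσ a≤sm p)
  where
  oσ′ : Odd (σ + suc m)
  oσ′ = odd+even σ (suc m) oσ em

  on-rest : ∀ x → RGTail (m ⊔ a) x → ¬ TailBefore (σ + suc m) x (suc (suc m) ∷ replicate j 0)
  on-rest []       _         p′ = before-nilˡ p′
  on-rest (a′ ∷ x) (a′≤ , _) p′ =
    zeros-minimal (σ + suc m + suc (suc m)) j x (odd+odd (σ + suc m) (suc (suc m)) oσ′ (even⇒odd-suc (suc m) em))
      (descend (σ + suc m) oσ′ (≤-trans a′≤ (s≤s (⊔-lub (n≤1+n m) a≤sm))) p′)

first-unique : ∀ {S : List ℕ → Set} {c t} → S c → (∀ u → S u → ¬ (u ≺ c)) →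
  IsFirst S t → t ≡ c
first-unique {c = c} {t} Sc no-pred (St , t-first) with ≡-dec _≟_ t c
... | yes t≡c = t≡c
... | no  t≢c = ⊥-elim (no-pred t St (t-first _ Sc (λ c≡t → t≢c (sym c≡t))))

first-in-prefix : ∀ {b n h s t} y → IsRGF≤ b (h ∷ s) → ValidTail (maxL (h ∷ s)) b y →
  length ((h ∷ s) ++ y) ≡ n →
  (∀ x → ValidTail (maxL (h ∷ s)) b x → ¬ TailBefore (sum (h ∷ s)) x y) →
  IsFirst (InPrefixR (h ∷ s) n b) t → t ≡ (h ∷ s) ++ y
first-in-prefix {b} {n} {h} {s} y vs vy len minimal =
  first-unique ((len , prefix-join h s y vs vy) , y , refl) no-predecessor
  where
  no-predecessor : ∀ u → InPrefixR (h ∷ s) n b u → ¬ (u ≺ ((h ∷ s) ++ y))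
  no-predecessor _ ((_ , vu) , x , refl) u≺ =
    minimal x (proj₂ (prefix-split h s x vu)) (before-++ 0 (h ∷ s) (≺⇒before u≺))

padded-length : ∀ s ys n → length s + length ys ≤ n →
  length (s ++ ys ++ replicate (n ∸ length s ∸ length ys) 0) ≡ n
padded-length s ys n fits = begin
  length (s ++ ys ++ replicate (n ∸ k ∸ j) 0)   ≡⟨ length-++ s ⟩
  k + length (ys ++ replicate (n ∸ k ∸ j) 0)    ≡⟨ cong (k +_) (length-++ ys) ⟩
  k + (j + length (replicate (n ∸ k ∸ j) 0))    ≡⟨ cong (λ l → k + (j + l)) (length-replicate (n ∸ k ∸ j)) ⟩
  k + (j + (n ∸ k ∸ j))                         ≡⟨ cong (λ l → k + (j + l)) (∸-+-assoc n k j) ⟩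
  k + (j + (n ∸ (k + j)))                       ≡⟨ sym (+-assoc k j _) ⟩
  k + j + (n ∸ (k + j))                         ≡⟨ m+[n∸m]≡n fits ⟩
  n                                             ∎
  where
  open ≡-Reasoning
  k = length s
  j = length ys

-- When M is
-- even it differs from the odd b, so M = m + 1 < b and m + 2 ≤ b.
proposition2 : (b n k : ℕ) (s : List ℕ) →
    1 ≤ b → Odd b → 1 ≤ k → k + 2 ≤ n → length s ≡ k →
    (∃[ u ] InPrefixR s n b u) →
    (t : List ℕ) → IsFirst (InPrefixR s n b) t →
    let M = b ⊓ suc (maxL s) in
    ((Odd (sum s) → Odd M → t ≡ s ++ (M ∷ replicate (n ∸ k ∸ 1) 0)) ×
     (Odd (sum s) → Even M → t ≡ s ++ (M ∷ suc M ∷ replicate (n ∸ k ∸ 2) 0)) ×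
     (Even (sum s) → t ≡ s ++ replicate (n ∸ k) 0))
proposition2 b n .0 [] _ _ () _ refl _ _ _
proposition2 b n _ (h ∷ s) _ ob _ fits refl (_ , (_ , vu) , r , refl) t first =
  odd-odd , odd-even , even
  where
  m = maxL (h ∷ s)
  M = b ⊓ suc m
  vs = proj₁ (prefix-split h s r vu)

  fits-≤ : ∀ {j} → j ≤ 2 → length (h ∷ s) + j ≤ n
  fits-≤ j≤2 = ≤-trans (+-monoʳ-≤ (length (h ∷ s)) j≤2) fits

  even : Even (sum (h ∷ s)) → t ≡ (h ∷ s) ++ replicate (n ∸ length (h ∷ s)) 0
  even eσ = first-in-prefix _ vs (zeros-valid m b _) (padded-length (h ∷ s) [] n (fits-≤ z≤n))
    (λ x _ → zeros-minimal (sum (h ∷ s)) _ x eσ) first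

  odd-odd : Odd (sum (h ∷ s)) → Odd M → t ≡ (h ∷ s) ++ (M ∷ replicate (n ∸ length (h ∷ s) ∸ 1) 0)
  odd-odd oσ oM = first-in-prefix _ vs
    (∷-valid (m⊓n≤n b (suc m)) (m⊓n≤m b (suc m)) (zeros-valid (m ⊔ M) b _))
    (padded-length (h ∷ s) (M ∷ []) n (fits-≤ (n≤1+n 1)))
    (λ x vx → single-minimal (sum (h ∷ s)) _ x oσ oM vx) first

  odd-even : Odd (sum (h ∷ s)) → Even M → t ≡ (h ∷ s) ++ (M ∷ suc M ∷ replicate (n ∸ length (h ∷ s) ∸ 2) 0)
  odd-even oσ eM = subst (λ c → t ≡ (h ∷ s) ++ (c ∷ suc c ∷ replicate (n ∸ length (h ∷ s) ∸ 2) 0))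
    (sym M≡sm)
    (first-in-prefix _ vs
      (∷-valid ≤-refl sm≤b (∷-valid (s≤s (m≤n⊔m m (suc m))) ssm≤b (zeros-valid _ b _)))
      (padded-length (h ∷ s) (suc m ∷ suc (suc m) ∷ []) n fits)
      (λ x vx → double-minimal (sum (h ∷ s)) m _ x oσ (subst Even M≡sm eM) (proj₁ vx)) first)
    where
    M≡sm : M ≡ suc m
    M≡sm = odd-⊓-even b (suc m) ob eM
    sm≤b : suc m ≤ b
    sm≤b = subst (_≤ b) M≡sm (m⊓n≤m b (suc m))
    ssm≤b : suc (suc m) ≤ b
    ssm≤b = ≤∧≢⇒< sm≤b (λ sm≡b → even≢odd b (subst Even (trans M≡sm sm≡b) eM) ob)
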